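{- In the setting described in the context, let $v\in B_d$ and let $u$ be the unique neighbor of $v$ in $C$. If $u$ receives more than $\frac{1}{3}$ from $v$ in Step 2, then $w(u)=2$ and $u$ has exactly one incident edge to $B\setminus(B_1\cup B_2)$.
   Context: Setting: $\mathcal{S}$ is an instance of the hereditary $3$-set packing problem, i.e., a finite family of nonempty sets of cardinality at most $3$ such that every nonempty subset of a member is a member; $w(s)=|s|-1$, $w(X)=\sum_{s\in X}w(s)$. A feasible solution is a subfamily of pairwise disjoint sets. $N(U,W)=\{x\in W:\exists u\in U:u\cap x\ne\emptyset\}$. A family $X\subseteq\mathcal{S}$ of pairwise disjoint sets is a local improvement of a feasible solution $A$ of size $|X|$ if $w(X)>w(N(X,A))$, or $w(X)=w(N(X,A))$ and $X$ contains more sets of weight $2$ than $N(X,A)$. $A$ is a feasible solution with no local improvement of size at most $10$ and $B$ is an optimum feasible solution; $A$ and $B$ consist of sets of cardinality $2$ or $3$. The conflict graph $G$ is the bipartite multigraph on $A\dot\cup B$ with exactly $|a\cap b|$ parallel edges between $a\in A$ and $b\in B$; neighbors, degrees and incident edges refer to $G$. $B_1$ is the set of $v\in B$ with exactly one neighbor in $A$; $B_2$ is the set of $v\in B$ with $w(v)=2$ having exactly two incident edges whose endpoints in $A$ are distinct. Step 1: each $v\in B_1$ sends $w(v)$ to its unique neighbor in $A$, and each $v\in B_2$ sends $1$ along each of its two edges. $C$ is the set of $u\in A$ whose total amount received in Step 1 equals exactly $w(u)$. (In this setting every $v\in B\setminus(B_1\cup B_2)$ has a neighbor in $A\setminus C$;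 if $w(v)=1$ it has exactly two neighbors in $A$, and if $w(v)=2$ it has exactly three incident edges.) $B_d$ is the set of $v\in B\setminus(B_1\cup B_2)$ with $w(v)=2$ such that exactly two of the three incident edges of $v$ go to $A\setminus C$ (so exactly one goes to $C$). Step 2 for $v\in B_d$: along each edge to a vertex $u'\in A\setminus C$, $v$ sends $1$ if $w(u')=2$ and $\frac{2}{3}$ if $w(u')=1$; along the edge to $C$ it sends the remaining amount, i.e., $2$ minus what it sent to $A\setminus C$. -}

module Defs where

open import Data.Nat using (ℕ; _+_; _*_; _∸_; _≤_; _<_; _>_; _≟_; _≤?_)
open import Data.Bool using (if_then_else_)
open import Data.Product using (_×_)
open import Data.Sum using (_⊎_)
open import Data.Fin.Subset using (Subset; _∩_; ∣_∣; _⊆_; Nonempty)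
open import Data.List using (List; []; _∷_; filter; length; map)
open import Data.Nat.ListAction using (sum)
open import Data.List.Membership.Propositional using (_∈_)
open import Data.List.Relation.Unary.Unique.Propositional using (Unique)
open import Data.List.Relation.Unary.Any using (any?)
open import Relation.Nullary using (¬_; Dec; does; yes; no; ¬?)
open import Relation.Nullary.Decidable using (_×-dec_)
open import Relation.Binary.PropositionalEquality using (_≡_; _≢_)

-- Ground set: Fin n.  A "set" is a Subset n; a family of sets is a list of
-- subsets (required to be duplicate-free where it represents a set of sets).

module _ {n : ℕ} where

  Family : Set
  Family = List (Subset n)

  w : Subset n → ℕ
  w s = ∣ s ∣ ∸ 1

  wF : Family → ℕ
  wF X = sum (map w X)

  count2 : Family → ℕ
  count2 X = length (filter (λ s → w s ≟ 2) X)

  Hereditary : Family → Set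
  Hereditary 𝒮 = ∀ {s t} → s ∈ 𝒮 → t ⊆ s → Nonempty t → t ∈ 𝒮

  IsInstance : Family → Set
  IsInstance 𝒮 = Unique 𝒮 × (∀ {s} → s ∈ 𝒮 → Nonempty s × ∣ s ∣ ≤ 3) × Hereditary 𝒮

  Disjoint : Subset n → Subset n → Set
  Disjoint a b = ∣ a ∩ b ∣ ≡ 0

  PairwiseDisjoint : Family → Set
  PairwiseDisjoint X = ∀ {a b} → a ∈ X → b ∈ X → a ≢ b → Disjoint a b

  SubFamily : Family → Family → Set
  SubFamily X 𝒮 = Unique X × (∀ {s} → s ∈ X → s ∈ 𝒮)

  Feasible : Family → Family → Set
  Feasible 𝒮 X = SubFamily X 𝒮 × PairwiseDisjoint X

  N : Family → Family → Family
  N U W = filter (λ x → any? (λ u → 1 ≤? ∣ u ∩ x ∣) U) W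

  LocalImprovement : Family → Family → Family → Set
  LocalImprovement 𝒮 A X =
    Feasible 𝒮 X ×
    (wF X > wF (N X A) ⊎ (wF X ≡ wF (N X A) × count2 X > count2 (N X A)))

  NoLocalImprovementUpTo : ℕ → Family → Family → Set
  NoLocalImprovementUpTo k 𝒮 A =
    ∀ (X : Family) → length X ≤ k → ¬ LocalImprovement 𝒮 A X

  Optimum : Family → Family → Set
  Optimum 𝒮 B = Feasible 𝒮 B × (∀ (F : Family) → Feasible 𝒮 F → wF F ≤ wF B)

  Card23 : Family → Set
  Card23 X = ∀ {s} → s ∈ X → ∣ s ∣ ≡ 2 ⊎ ∣ s ∣ ≡ 3

  -- Conflict graph: |a ∩ b| parallel edges between a ∈ A and b ∈ B.
  -- neighbours of v in the family A
  nbrs : Family → Subset n → Family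
  nbrs A v = N (v ∷ []) A

  edgesTo : Family → Subset n → ℕ
  edgesTo X v = sum (map (λ a → ∣ a ∩ v ∣) X)

  InB1 : Family → Subset n → Set
  InB1 A v = length (nbrs A v) ≡ 1

  InB1? : (A : Family) (v : Subset n) → Dec (InB1 A v)
  InB1? A v = length (nbrs A v) ≟ 1

  InB2 : Family → Subset n → Set
  InB2 A v = w v ≡ 2 × edgesTo A v ≡ 2 × length (nbrs A v) ≡ 2

  InB2? : (A : Family) (v : Subset n) → Dec (InB2 A v)
  InB2? A v = (w v ≟ 2) ×-dec (edgesTo A v ≟ 2) ×-dec (length (nbrs A v) ≟ 2)

  step1 : Family → Subset n → Subset n → ℕ
  step1 A v u with InB1? A v | InB2? A v
  ... | yes _ | _     = if does (1 ≤? ∣ u ∩ v ∣) then w v else 0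
  ... | no _  | yes _ = ∣ u ∩ v ∣
  ... | no _  | no _  = 0

  received1 : Family → Family → Subset n → ℕ
  received1 A B u = sum (map (λ v → step1 A v u) B)

  InC : Family → Family → Subset n → Set
  InC A B u = received1 A B u ≡ w u

  InC? : (A B : Family) (u : Subset n) → Dec (InC A B u)
  InC? A B u = received1 A B u ≟ w u

  Cset : Family → Family → Family
  Cset A B = filter (InC? A B) A

  AminusC : Family → Family → Family
  AminusC A B = filter (λ u → ¬? (InC? A B u)) A

  Brest : Family → Family → Family
  Brest A B = filter (λ v → ¬? (InB1? A v) ×-dec ¬? (InB2? A v)) B

  InBd : Family → Family → Subset n → Set
  InBd A B v =
    v ∈ B × ¬ InB1 A v × ¬ InB2 A v × w v ≡ 2 ×
    edgesTo (AminusC A B) v ≡ 2 × edgesTo (Cset A B) v ≡ 1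

  -- Step 2, amounts measured in units of 1/3:
  -- along an edge to u' ∈ A \ C, v sends 1 (= 3 thirds) if w(u') = 2,
  -- and 2/3 (= 2 thirds) if w(u') = 1.
  rate3 : Subset n → ℕ
  rate3 u' = if does (w u' ≟ 2) then 3 else 2

  sentOut3 : Family → Family → Subset n → ℕ
  sentOut3 A B v = sum (map (λ a → ∣ a ∩ v ∣ * rate3 a) (AminusC A B))

  -- three times the amount v sends along its edge to C (2 minus what it sent to A \ C)
  toC3 : Family → Family → Subset n → ℕ
  toC3 A B v = 6 ∸ sentOut3 A B v

-- As v has a single edge into C, |u ∩ v| = 1, and as v keeps more than 1/3 for u, every other
-- neighbour of v in A has weight 1.  So a set t ∈ 𝒮 disjoint from v, with w t = w u and no
-- neighbour in A besides u, would make {v, t} a local improvement: it replaces the neighbours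
-- of v, of total weight at most 2 + w u and among which only u can have weight 2.
-- Being in C, u receives w u in Step 1 from some c ∈ B₁ ∪ B₂.  If w u = 1, then c has fewer
-- edges to A than elements, and t = {p, q} with p ∈ u ∩ c and q ∈ c outside every set of A
-- works.  If w u = 2 and u had a second edge into B ∖ (B₁ ∪ B₂), all Step-1 flow into u would
-- pass through the one remaining point of u, so c would be the only donor and give 2; then
-- c ∉ B₂, and t = c ∈ B₁ works.

{-# OPTIONS --safe #-}
module Submission where

open import Defs
open import Data.Bool using (true; false; if_then_else_)
import Data.Bool as Bool
open import Data.Empty using (⊥; ⊥-elim)
open import Data.Fin using (Fin)
import Data.Fin.Properties as Fin
open import Data.Fin.Subset
  using (Subset; _∩_; _∪_; ∣_∣; ⁅_⁆; ⋃; Empty) renaming (_∈_ to _∈ₛ_; _∉_ to _∉ₛ_)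
open import Data.Fin.Subset.Properties
  using ( _∈?_; nonempty?; Empty-unique; ∣⊥∣≡0; ∣⁅x⁆∣≡1; ∣p∣≤∣x∷p∣; p⊆q⇒∣p∣≤∣q∣; x∈p⇒∣p-x∣<∣p∣
        ; x∈p∧x≢y⇒x∈p-y; x∈⁅x⁆; x∈⁅y⁆⇒x≡y; x∈p∩q⁺; x∈p∩q⁻; x∈p∪q⁺; x∈p∪q⁻; ∩-comm)
open import Data.List using (List; []; _∷_; filter; length; map)
open import Data.List.Properties using (filter-accept; filter-none)
open import Data.List.Membership.Propositional using (_∈_; find; lose)
open import Data.List.Membership.Propositional.Properties using (∈-filter⁺; ∈-filter⁻)
open import Data.List.Relation.Unary.All using (All; []; _∷_)
open import Data.List.Relation.Unary.All.Properties using (¬Any⇒All¬)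
import Data.List.Relation.Unary.All as All
open import Data.List.Relation.Unary.AllPairs using ([]; _∷_)
open import Data.List.Relation.Unary.Any using (Any; here; there; any?)
import Data.List.Relation.Unary.Any as Any
open import Data.List.Relation.Unary.Unique.Propositional using (Unique)
import Data.List.Relation.Unary.Unique.Propositional.Properties as Unique
open import Data.Nat
  using (ℕ; zero; suc; _+_; _*_; _∸_; _≤_; _<_; z≤n; s≤s; _≤?_)
import Data.Nat as ℕ
open import Data.Nat.ListAction using (sum)
open import Data.Nat.Properties
open import Algebra.Properties.CommutativeSemigroup +-commutativeSemigroup
  using (x∙yz≈y∙xz; xy∙z≈xz∙y)
open import Data.Product using (_×_; _,_; proj₁; proj₂; ∃-syntax)
open import Data.Sum using (_⊎_; inj₁; inj₂; [_,_]′)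
import Data.Sum
open import Data.Vec using ([]; _∷_)
open import Data.Vec.Properties using (≡-dec)
open import Function using (_∘_; id)
open import Relation.Binary using (DecidableEquality)
open import Relation.Binary.PropositionalEquality
  using (_≡_; _≢_; refl; sym; trans; cong; cong₂; subst; subst₂; module ≡-Reasoning)
open import Relation.Nullary using (¬_; Dec; yes; no; ¬?; does; contradiction)
open import Relation.Nullary.Decidable using (_×-dec_; decidable-stable)
open import Relation.Unary using (Decidable)

module _ {A : Set} (f : A → ℕ) where

  ∈⇒≤sum : ∀ {x xs} → x ∈ xs → f x ≤ sum (map f xs)
  ∈⇒≤sum {xs = y ∷ xs} (here refl) = m≤m+n (f y) _
  ∈⇒≤sum {xs = y ∷ xs} (there x∈) = ≤-trans (∈⇒≤sum x∈) (m≤n+m _ (f y))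

  distinct-∈⇒+≤sum : ∀ {x y xs} → x ∈ xs → y ∈ xs → x ≢ y → f x + f y ≤ sum (map f xs)
  distinct-∈⇒+≤sum (here refl) (here refl) x≢y = ⊥-elim (x≢y refl)
  distinct-∈⇒+≤sum {x} (here refl) (there y∈) _ = +-monoʳ-≤ (f x) (∈⇒≤sum y∈)
  distinct-∈⇒+≤sum {x} {y} {_ ∷ xs} (there x∈) (here refl) _ = begin
    f x + f y            ≡⟨ +-comm (f x) (f y) ⟩
    f y + f x            ≤⟨ +-monoʳ-≤ (f y) (∈⇒≤sum x∈) ⟩
    f y + sum (map f xs) ∎
    where open ≤-Reasoning
  distinct-∈⇒+≤sum {xs = z ∷ _} (there x∈) (there y∈) x≢y =
    ≤-trans (distinct-∈⇒+≤sum x∈ y∈ x≢y) (m≤n+m _ (f z))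

  sum-positive⇒∃ : ∀ xs → 1 ≤ sum (map f xs) → ∃[ x ] x ∈ xs × 1 ≤ f x
  sum-positive⇒∃ (x ∷ xs) h with f x in fx≡
  ... | suc _ = x , here refl , subst (1 ≤_) (sym fx≡) (s≤s z≤n)
  ... | zero  = let y , y∈ , fy = sum-positive⇒∃ xs h in y , there y∈ , fy

  sum-map-zero : ∀ xs → (∀ {x} → x ∈ xs → f x ≡ 0) → sum (map f xs) ≡ 0
  sum-map-zero []       _    = refl
  sum-map-zero (x ∷ xs) f≡0 rewrite f≡0 (here refl) = sum-map-zero xs (f≡0 ∘ there)

  sum-map-*ʳ : ∀ k xs → sum (map (λ x → f x * k) xs) ≡ sum (map f xs) * k
  sum-map-*ʳ k []       = refl
  sum-map-*ʳ k (x ∷ xs) =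
    trans (cong (f x * k +_) (sum-map-*ʳ k xs)) (sym (*-distribʳ-+ k (f x) _))

  module _ {P : A → Set} (P? : Decidable P) where

    sum-filter+sum-filter-∁ : ∀ xs →
      sum (map f (filter P? xs)) + sum (map f (filter (¬? ∘ P?) xs)) ≡ sum (map f xs)
    sum-filter+sum-filter-∁ []       = refl
    sum-filter+sum-filter-∁ (x ∷ xs) with P? x
    ... | yes _ = trans (+-assoc (f x) _ _) (cong (f x +_) (sum-filter+sum-filter-∁ xs))
    ... | no  _ = trans (x∙yz≈y∙xz (sum (map f (filter P? xs))) (f x) _)
                        (cong (f x +_) (sum-filter+sum-filter-∁ xs))

module _ {A : Set} (f g : A → ℕ) where

  sum-mono-≤ : ∀ xs → (∀ {x} → x ∈ xs → f x ≤ g x) → sum (map f xs) ≤ sum (map g xs)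
  sum-mono-≤ []       _ = z≤n
  sum-mono-≤ (x ∷ xs) f≤g = +-mono-≤ (f≤g (here refl)) (sum-mono-≤ xs (f≤g ∘ there))

  sum-mono-< : ∀ {y} xs → (∀ {x} → x ∈ xs → f x ≤ g x) → y ∈ xs → f y < g y →
               sum (map f xs) < sum (map g xs)
  sum-mono-< (x ∷ xs) f≤g (here refl) fy<gy = +-mono-<-≤ fy<gy (sum-mono-≤ xs (f≤g ∘ there))
  sum-mono-< (x ∷ xs) f≤g (there y∈) fy<gy =
    +-mono-≤-< (f≤g (here refl)) (sum-mono-< xs (f≤g ∘ there) y∈ fy<gy)

  module _ {P : A → Set} (P? : Decidable P) where

    sum-filter-≤ : ∀ xs → (∀ {x} → x ∈ xs → P x → f x ≤ g x) →
                   sum (map f (filter P? xs)) ≤ sum (map g xs)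
    sum-filter-≤ []       _ = z≤n
    sum-filter-≤ (x ∷ xs) f≤g with P? x
    ... | yes px = +-mono-≤ (f≤g (here refl) px) (sum-filter-≤ xs (f≤g ∘ there))
    ... | no  _  = ≤-trans (sum-filter-≤ xs (f≤g ∘ there)) (m≤n+m _ (g x))

module _ {A : Set} (_≟_ : DecidableEquality A) where

  module _ (f : A → ℕ) where

    others-zero⇒sum≤ : ∀ {y} xs → Unique xs → (∀ {x} → x ∈ xs → x ≢ y → f x ≡ 0) →
                       sum (map f xs) ≤ f y
    others-zero⇒sum≤ []       _ _ = z≤n
    others-zero⇒sum≤ {y} (x ∷ xs) (x∉xs ∷ xs!) zero-off-y with x ≟ y
    ... | no x≢y rewrite zero-off-y (here refl) x≢y = others-zero⇒sum≤ xs xs! (zero-off-y ∘ there)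
    ... | yes refl = ≤-reflexive (begin
      f x + sum (map f xs) ≡⟨ cong (f x +_) (sum-map-zero f xs zero-on-xs) ⟩
      f x + 0              ≡⟨ +-identityʳ (f x) ⟩
      f x                  ∎)
      where
      open ≡-Reasoning
      zero-on-xs : ∀ {z} → z ∈ xs → f z ≡ 0
      zero-on-xs z∈ = zero-off-y (there z∈) (All.lookup x∉xs z∈ ∘ sym)

    >single⇒∃other : ∀ {y} xs → Unique xs → f y < sum (map f xs) →
                     ∃[ x ] x ∈ xs × x ≢ y × 1 ≤ f x
    >single⇒∃other {y} xs xs! fy<sum
      with any? (λ x → ¬? (x ≟ y) ×-dec (1 ≤? f x)) xs
    ... | yes some = find some
    ... | no  none = ⊥-elim (<⇒≱ fy<sum (others-zero⇒sum≤ xs xs! zero-off-y))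
      where
      zero-off-y : ∀ {x} → x ∈ xs → x ≢ y → f x ≡ 0
      zero-off-y {x} x∈ x≢y = n≤0⇒n≡0 (≮⇒≥ (λ 1≤fx → none (Any.map (λ { refl → x≢y , 1≤fx }) x∈)))

  module _ (f g : A → ℕ) {P : A → Set} (P? : Decidable P) where

    sum-filter-≤-except : ∀ {y} k xs → Unique xs → f y ≤ g y + k →
      (∀ {x} → x ∈ xs → P x → x ≢ y → f x ≤ g x) →
      sum (map f (filter P? xs)) ≤ sum (map g xs) + k
    sum-filter-≤-except k []       _ _ _ = z≤n
    sum-filter-≤-except {y} k (x ∷ xs) (x∉xs ∷ xs!) fy≤ f≤g with x ≟ y | P? x
    ... | yes refl | yes _ = begin
      f x + sum (map f (filter P? xs)) ≤⟨ +-mono-≤ fy≤ (sum-filter-≤ f g P? xs f≤g-on-xs) ⟩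
      g x + k + sum (map g xs)         ≡⟨ xy∙z≈xz∙y (g x) k _ ⟩
      g x + sum (map g xs) + k         ∎
      where
      open ≤-Reasoning
      f≤g-on-xs : ∀ {z} → z ∈ xs → P z → f z ≤ g z
      f≤g-on-xs z∈ pz = f≤g (there z∈) pz (All.lookup x∉xs z∈ ∘ sym)
    ... | yes refl | no _ = begin
      sum (map f (filter P? xs))
        ≤⟨ sum-filter-≤ f g P? xs (λ z∈ pz → f≤g (there z∈) pz (All.lookup x∉xs z∈ ∘ sym)) ⟩
      sum (map g xs)             ≤⟨ m≤n+m _ (g x) ⟩
      g x + sum (map g xs)       ≤⟨ m≤m+n _ k ⟩
      g x + sum (map g xs) + k   ∎
      where open ≤-Reasoning
    ... | no x≢y | yes px = ≤-trans
      (+-mono-≤ (f≤g (here refl) px x≢y) (sum-filter-≤-except k xs xs! fy≤ (f≤g ∘ there)))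
      (≤-reflexive (sym (+-assoc (g x) _ k)))
    ... | no _ | no _ = ≤-trans (sum-filter-≤-except k xs xs! fy≤ (f≤g ∘ there))
                                (+-monoˡ-≤ k (m≤n+m _ (g x)))

module _ {A : Set} where

  Unique-≡⇒length≤1 : ∀ {y} (xs : List A) → Unique xs → (∀ {x} → x ∈ xs → x ≡ y) → length xs ≤ 1
  Unique-≡⇒length≤1 []           _                 _    = z≤n
  Unique-≡⇒length≤1 (_ ∷ [])     _                 _    = ≤-refl
  Unique-≡⇒length≤1 (_ ∷ _ ∷ _) ((x≢x′ ∷ _) ∷ _) all≡ =
    ⊥-elim (x≢x′ (trans (all≡ (here refl)) (sym (all≡ (there (here refl))))))

  length≡1⇒∈-≡ : ∀ {x y} (xs : List A) → length xs ≡ 1 → x ∈ xs → y ∈ xs → x ≡ y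
  length≡1⇒∈-≡ (_ ∷ []) _ (here refl) (here refl) = refl

∣p∪q∣≤∣p∣+∣q∣ : ∀ {n} (p q : Subset n) → ∣ p ∪ q ∣ ≤ ∣ p ∣ + ∣ q ∣
∣p∪q∣≤∣p∣+∣q∣ [] [] = z≤n
∣p∪q∣≤∣p∣+∣q∣ (true  ∷ p) (t     ∷ q) =
  s≤s (≤-trans (∣p∪q∣≤∣p∣+∣q∣ p q) (+-monoʳ-≤ ∣ p ∣ (∣p∣≤∣x∷p∣ t q)))
∣p∪q∣≤∣p∣+∣q∣ (false ∷ p) (true  ∷ q) =
  ≤-trans (s≤s (∣p∪q∣≤∣p∣+∣q∣ p q)) (≤-reflexive (sym (+-suc ∣ p ∣ ∣ q ∣)))
∣p∪q∣≤∣p∣+∣q∣ (false ∷ p) (false ∷ q) = ∣p∪q∣≤∣p∣+∣q∣ p q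

module _ {n : ℕ} where

  Empty⇒∣p∣≡0 : ∀ {p : Subset n} → Empty p → ∣ p ∣ ≡ 0
  Empty⇒∣p∣≡0 empty = trans (cong ∣_∣ (Empty-unique empty)) (∣⊥∣≡0 n)

  x∈p⇒1≤∣p∣ : ∀ {x} {p : Subset n} → x ∈ₛ p → 1 ≤ ∣ p ∣
  x∈p⇒1≤∣p∣ x∈p = ≤-trans (s≤s z≤n) (x∈p⇒∣p-x∣<∣p∣ x∈p)

  1≤∣p∩q∣⇒∃ : ∀ (p q : Subset n) → 1 ≤ ∣ p ∩ q ∣ → ∃[ x ] x ∈ₛ p × x ∈ₛ q
  1≤∣p∩q∣⇒∃ p q 1≤∣p∩q∣ with nonempty? (p ∩ q)
  ... | yes (x , x∈p∩q) = x , x∈p∩q⁻ p q x∈p∩q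
  ... | no  empty       = ⊥-elim (1+n≰n (subst (1 ≤_) (Empty⇒∣p∣≡0 empty) 1≤∣p∩q∣))

  ∈-both⇒1≤∣p∩q∣ : ∀ {x} {p q : Subset n} → x ∈ₛ p → x ∈ₛ q → 1 ≤ ∣ p ∩ q ∣
  ∈-both⇒1≤∣p∩q∣ x∈p x∈q = x∈p⇒1≤∣p∣ (x∈p∩q⁺ (x∈p , x∈q))

  no-common⇒∣p∩q∣≡0 : ∀ (p q : Subset n) → (∀ {x} → x ∈ₛ p → x ∉ₛ q) → ∣ p ∩ q ∣ ≡ 0
  no-common⇒∣p∩q∣≡0 p q apart =
    Empty⇒∣p∣≡0 (λ (x , x∈p∩q) → let x∈p , x∈q = x∈p∩q⁻ p q x∈p∩q in apart x∈p x∈q)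

  subsingleton⇒∣p∣≤1 : ∀ (p : Subset n) → (∀ {x y} → x ∈ₛ p → y ∈ₛ p → x ≡ y) → ∣ p ∣ ≤ 1
  subsingleton⇒∣p∣≤1 p p! with nonempty? p
  ... | no  empty      = ≤-trans (≤-reflexive (Empty⇒∣p∣≡0 empty)) z≤n
  ... | yes (x , x∈p) = subst (∣ p ∣ ≤_) (∣⁅x⁆∣≡1 x)
    (p⊆q⇒∣p∣≤∣q∣ (λ y∈p → subst (_∈ₛ ⁅ x ⁆) (p! x∈p y∈p) (x∈⁅x⁆ x)))

  Unique⇒length≤∣p∣ : ∀ {p : Subset n} xs → Unique xs → All (_∈ₛ p) xs → length xs ≤ ∣ p ∣
  Unique⇒length≤∣p∣ []       _            _            = z≤n
  Unique⇒length≤∣p∣ (x ∷ xs) (x∉xs ∷ xs!) (x∈p ∷ xs⊆p) =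
    ≤-trans (s≤s (Unique⇒length≤∣p∣ xs xs! xs⊆p-x)) (x∈p⇒∣p-x∣<∣p∣ x∈p)
    where
    xs⊆p-x = All.zipWith (λ (y∈p , x≢y) → x∈p∧x≢y⇒x∈p-y y∈p (x≢y ∘ sym)) (xs⊆p , x∉xs)

  at-most-one-outside : ∀ {p : Subset n} xs → Unique xs → All (_∈ₛ p) xs →
    ∣ p ∣ ≤ suc (length xs) → ∀ {y z} → y ∈ₛ p → z ∈ₛ p → ¬ y ∈ xs → ¬ z ∈ xs → y ≡ z
  at-most-one-outside xs xs! xs⊆p ∣p∣≤ {y} {z} y∈p z∈p y∉xs z∉xs = decidable-stable (y Fin.≟ z)
    λ y≢z → 1+n≰n (≤-trans (Unique⇒length≤∣p∣ (y ∷ z ∷ xs) (yzxs! y≢z) (y∈p ∷ z∈p ∷ xs⊆p)) ∣p∣≤)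
    where
    yzxs! : y ≢ z → Unique (y ∷ z ∷ xs)
    yzxs! y≢z = (y≢z ∷ ¬Any⇒All¬ xs y∉xs) ∷ ¬Any⇒All¬ xs z∉xs ∷ xs!

  ∣⁅x⁆∪⁅y⁆∣≡2 : ∀ {x y : Fin n} → x ≢ y → ∣ ⁅ x ⁆ ∪ ⁅ y ⁆ ∣ ≡ 2
  ∣⁅x⁆∪⁅y⁆∣≡2 {x} {y} x≢y = ≤-antisym
    (≤-trans (∣p∪q∣≤∣p∣+∣q∣ ⁅ x ⁆ ⁅ y ⁆) (≤-reflexive (cong₂ _+_ (∣⁅x⁆∣≡1 x) (∣⁅x⁆∣≡1 y))))
    (Unique⇒length≤∣p∣ (x ∷ y ∷ []) ((x≢y ∷ []) ∷ [] ∷ [])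
      (x∈p∪q⁺ (inj₁ (x∈⁅x⁆ x)) ∷ x∈p∪q⁺ (inj₂ (x∈⁅x⁆ y)) ∷ []))

  x∈⁅y⁆∪⁅z⁆⁻ : ∀ {x} (y z : Fin n) → x ∈ₛ ⁅ y ⁆ ∪ ⁅ z ⁆ → x ≡ y ⊎ x ≡ z
  x∈⁅y⁆∪⁅z⁆⁻ y z = Data.Sum.map (x∈⁅y⁆⇒x≡y y) (x∈⁅y⁆⇒x≡y z) ∘ x∈p∪q⁻ ⁅ y ⁆ ⁅ z ⁆

  module _ {A : Set} (f : A → Subset n) where

    x∈⋃⁺ : ∀ {x a xs} → a ∈ xs → x ∈ₛ f a → x ∈ₛ ⋃ (map f xs)
    x∈⋃⁺ {xs = b ∷ _} (here refl) x∈fa = x∈p∪q⁺ (inj₁ x∈fa)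
    x∈⋃⁺ {xs = b ∷ _} (there a∈)  x∈fa = x∈p∪q⁺ (inj₂ (x∈⋃⁺ a∈ x∈fa))

    ∣⋃∣≤sum : ∀ xs → ∣ ⋃ (map f xs) ∣ ≤ sum (map (∣_∣ ∘ f) xs)
    ∣⋃∣≤sum []       = ≤-reflexive (∣⊥∣≡0 n)
    ∣⋃∣≤sum (x ∷ xs) = ≤-trans (∣p∪q∣≤∣p∣+∣q∣ (f x) _) (+-monoʳ-≤ ∣ f x ∣ (∣⋃∣≤sum xs))

  edges<∣c∣⇒∃uncovered : ∀ (c : Subset n) (as : List (Subset n)) →
    sum (map (λ a → ∣ a ∩ c ∣) as) < ∣ c ∣ → ∃[ q ] q ∈ₛ c × ¬ Any (q ∈ₛ_) as
  edges<∣c∣⇒∃uncovered c as edges<∣c∣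
    with Fin.any? (λ q → (q ∈? c) ×-dec ¬? (any? (q ∈?_) as))
  ... | yes uncovered = uncovered
  ... | no  none      = ⊥-elim (<⇒≱ edges<∣c∣ (≤-trans (p⊆q⇒∣p∣≤∣q∣ c⊆⋃) (∣⋃∣≤sum (_∩ c) as)))
    where
    c⊆⋃ : ∀ {q} → q ∈ₛ c → q ∈ₛ ⋃ (map (_∩ c) as)
    c⊆⋃ {q} q∈c =
      let covered = decidable-stable (any? (q ∈?_) as) (λ ¬cov → none (q , q∈c , ¬cov))
          a , a∈as , q∈a = find covered
      in x∈⋃⁺ (_∩ c) a∈as (x∈p∩q⁺ (q∈a , q∈c))

module _ {n : ℕ} where

  _≟ₛ_ : DecidableEquality (Subset n)
  _≟ₛ_ = ≡-dec Bool._≟_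

  1≤∣p∩q∣-comm : ∀ {p q : Subset n} → 1 ≤ ∣ p ∩ q ∣ → 1 ≤ ∣ q ∩ p ∣
  1≤∣p∩q∣-comm {p} {q} = subst (1 ≤_) (cong ∣_∣ (∩-comm p q))

  Card23⇒w≡1⊎w≡2 : ∀ {X : List (Subset n)} → Card23 X → ∀ {s} → s ∈ X → w s ≡ 1 ⊎ w s ≡ 2
  Card23⇒w≡1⊎w≡2 card23 s∈X = Data.Sum.map (cong (_∸ 1)) (cong (_∸ 1)) (card23 s∈X)

  Card23⇒2≤∣s∣ : ∀ {X : List (Subset n)} → Card23 X → ∀ {s} → s ∈ X → 2 ≤ ∣ s ∣
  Card23⇒2≤∣s∣ card23 s∈X =
    [ ≤-reflexive ∘ sym , (λ ∣s∣≡3 → subst (2 ≤_) (sym ∣s∣≡3) (n≤1+n 2)) ]′ (card23 s∈X)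

  Card23⇒1≤w : ∀ {X : List (Subset n)} → Card23 X → ∀ {s} → s ∈ X → 1 ≤ w s
  Card23⇒1≤w card23 s∈X = ∸-monoˡ-≤ 1 (Card23⇒2≤∣s∣ card23 s∈X)

  w≡2⇒∣s∣≡3 : ∀ {s : Subset n} → w s ≡ 2 → ∣ s ∣ ≡ 3
  w≡2⇒∣s∣≡3 {s} = pred≡2⇒≡3 ∣ s ∣
    where
    pred≡2⇒≡3 : ∀ m → m ∸ 1 ≡ 2 → m ≡ 3
    pred≡2⇒≡3 (suc m) m≡2 = cong suc m≡2

  module _ {X : List (Subset n)} (disjoint : PairwiseDisjoint X)
           {c d : Subset n} (c∈X : c ∈ X) (d∈X : d ∈ X) where

    common-point⇒≡ : ∀ {x} → x ∈ₛ c → x ∈ₛ d → c ≡ d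
    common-point⇒≡ x∈c x∈d = decidable-stable (c ≟ₛ d)
      (λ c≢d → 1+n≰n (subst (1 ≤_) (disjoint c∈X d∈X c≢d) (∈-both⇒1≤∣p∩q∣ x∈c x∈d)))

    ≢⇒∉ : c ≢ d → ∀ {x} → x ∈ₛ c → x ∉ₛ d
    ≢⇒∉ c≢d x∈c x∈d = c≢d (common-point⇒≡ x∈c x∈d)

  pair-feasible : ∀ {𝒮 : List (Subset n)} {s t} → s ∈ 𝒮 → t ∈ 𝒮 → s ≢ t → Disjoint s t →
                  Feasible 𝒮 (s ∷ t ∷ [])
  pair-feasible {𝒮} {s} {t} s∈𝒮 t∈𝒮 s≢t s∩t≡0 = (((s≢t ∷ []) ∷ [] ∷ []) , members) , disjoint
    where
    members : ∀ {r} → r ∈ s ∷ t ∷ [] → r ∈ 𝒮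
    members (here refl)         = s∈𝒮
    members (there (here refl)) = t∈𝒮
    disjoint : PairwiseDisjoint (s ∷ t ∷ [])
    disjoint (here refl)         (here refl)         s≢s = ⊥-elim (s≢s refl)
    disjoint (here refl)         (there (here refl)) _   = s∩t≡0
    disjoint (there (here refl)) (here refl)         _   = trans (cong ∣_∣ (∩-comm t s)) s∩t≡0
    disjoint (there (here refl)) (there (here refl)) t≢t = ⊥-elim (t≢t refl)

  weight≤∧count2<⇒LocalImprovement : ∀ {𝒮 A X : List (Subset n)} → Feasible 𝒮 X →
    wF (N X A) ≤ wF X → count2 (N X A) < count2 X → LocalImprovement 𝒮 A X
  weight≤∧count2<⇒LocalImprovement feasible wN≤wX count2< =
    feasible , Data.Sum.map id (λ wN≡wX → sym wN≡wX , count2<) (m≤n⇒m<n∨m≡n wN≤wX)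

  Meets : List (Subset n) → Subset n → Set
  Meets X a = Any (λ s → 1 ≤ ∣ s ∩ a ∣) X

  meets? : ∀ X → Decidable (Meets X)
  meets? X a = any? (λ s → 1 ≤? ∣ s ∩ a ∣) X

  1≤∣a∩c∣⇒∈nbrs : ∀ {A : List (Subset n)} {a c} → a ∈ A → 1 ≤ ∣ a ∩ c ∣ → a ∈ nbrs A c
  1≤∣a∩c∣⇒∈nbrs {a = a} {c} a∈A 1≤∣a∩c∣ =
    ∈-filter⁺ (meets? (c ∷ [])) a∈A (here (1≤∣p∩q∣-comm {p = a} 1≤∣a∩c∣))

  InB1⇒unique-neighbour : ∀ {A : List (Subset n)} {c a a′} → InB1 A c → a ∈ A → a′ ∈ A →
    1 ≤ ∣ a ∩ c ∣ → 1 ≤ ∣ a′ ∩ c ∣ → a ≡ a′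
  InB1⇒unique-neighbour {A} {c} c∈B₁ a∈A a′∈A a∩c a′∩c =
    length≡1⇒∈-≡ (nbrs A c) c∈B₁ (1≤∣a∩c∣⇒∈nbrs a∈A a∩c) (1≤∣a∩c∣⇒∈nbrs a′∈A a′∩c)

  W2? : (s : Subset n) → Dec (w s ≡ 2)
  W2? s = w s ℕ.≟ 2

  count2-∷-w≡2 : ∀ {s} X → w s ≡ 2 → count2 (s ∷ X) ≡ suc (count2 X)
  count2-∷-w≡2 {s} X ws≡2 = cong length (filter-accept W2? {s} {X} ws≡2)

  count2≤count2-singleton : ∀ {u t} xs → Unique xs → (∀ {a} → a ∈ xs → w a ≡ 2 → a ≡ u) →
    w t ≡ w u → count2 xs ≤ count2 (t ∷ [])
  count2≤count2-singleton {u} {t} xs xs! only-u wt≡wu with w t ℕ.≟ 2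
  ... | yes wt≡2 = begin
    count2 xs       ≤⟨ Unique-≡⇒length≤1 (filter W2? xs) (Unique.filter⁺ W2? xs!) weight2⇒≡u ⟩
    1               ≡⟨ cong length (filter-accept W2? {t} {[]} wt≡2) ⟨
    count2 (t ∷ []) ∎
    where
    open ≤-Reasoning
    weight2⇒≡u : ∀ {a} → a ∈ filter W2? xs → a ≡ u
    weight2⇒≡u a∈ = let a∈xs , wa≡2 = ∈-filter⁻ W2? a∈ in only-u a∈xs wa≡2
  ... | no wt≢2 = ≤-trans (≤-reflexive (cong length (filter-none W2? (All.tabulate not-w2)))) z≤n
    where
    not-w2 : ∀ {a} → a ∈ xs → w a ≢ 2
    not-w2 a∈xs wa≡2 = wt≢2 (trans wt≡wu (subst (λ b → w b ≡ 2) (only-u a∈xs wa≡2) wa≡2))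

  step1-positive⇒ : ∀ (A : List (Subset n)) c u → 1 ≤ step1 A c u →
    1 ≤ ∣ u ∩ c ∣ × (InB1 A c × step1 A c u ≡ w c ⊎ InB2 A c × step1 A c u ≡ ∣ u ∩ c ∣)
  step1-positive⇒ A c u 1≤step with InB1? A c | InB2? A c
  ... | yes c∈B₁ | _ =
    let u∩c , step≡wc = positive-indicator ∣ u ∩ c ∣ (w c) 1≤step in u∩c , inj₁ (c∈B₁ , step≡wc)
    where
    positive-indicator : ∀ k m → 1 ≤ (if does (1 ≤? k) then m else 0) →
                         1 ≤ k × (if does (1 ≤? k) then m else 0) ≡ m
    positive-indicator (suc _) _ _ = s≤s z≤n , refl
  step1-positive⇒ A c u 1≤step | no _ | yes c∈B₂ = 1≤step , inj₂ (c∈B₂ , refl)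
  step1-positive⇒ A c u 1≤step | no _ | no  _    = ⊥-elim (1+n≰n 1≤step)

  InC⇒∃donor : ∀ {A B : List (Subset n)} {u} → Card23 A → u ∈ A → InC A B u →
    ∃[ c ] c ∈ B × 1 ≤ step1 A c u
  InC⇒∃donor {A} {B} {u} card23 u∈A u∈C =
    sum-positive⇒∃ (λ c → step1 A c u) B (subst (1 ≤_) (sym u∈C) (Card23⇒1≤w card23 u∈A))

  2≤rate3 : ∀ (a : Subset n) → 2 ≤ rate3 a
  2≤rate3 a with does (w a ℕ.≟ 2)
  ... | true  = n≤1+n 2
  ... | false = ≤-refl

  w≡2⇒rate3≡3 : ∀ {a : Subset n} → w a ≡ 2 → rate3 a ≡ 3
  w≡2⇒rate3≡3 = cong (λ k → if does (k ℕ.≟ 2) then 3 else 2)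

  weight2-neighbour⇒2*edges<sentOut3 : ∀ {A B : List (Subset n)} {v a} → a ∈ AminusC A B →
    w a ≡ 2 → 1 ≤ ∣ a ∩ v ∣ → edgesTo (AminusC A B) v * 2 < sentOut3 A B v
  weight2-neighbour⇒2*edges<sentOut3 {A} {B} {v} {a} a∈A∖C wa≡2 a∩v = begin-strict
    edgesTo (AminusC A B) v * 2              ≡⟨ sum-map-*ʳ (λ b → ∣ b ∩ v ∣) 2 (AminusC A B) ⟨
    sum (map (λ b → ∣ b ∩ v ∣ * 2) (AminusC A B))
      <⟨ sum-mono-< (λ b → ∣ b ∩ v ∣ * 2) (λ b → ∣ b ∩ v ∣ * rate3 b) (AminusC A B)
           (λ {b} _ → *-monoʳ-≤ ∣ b ∩ v ∣ (2≤rate3 b)) a∈A∖C a-gains ⟩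
    sentOut3 A B v                           ∎
    where
    open ≤-Reasoning
    a-gains : ∣ a ∩ v ∣ * 2 < ∣ a ∩ v ∣ * rate3 a
    a-gains = begin-strict
      ∣ a ∩ v ∣ * 2             <⟨ m<n+m _ a∩v ⟩
      ∣ a ∩ v ∣ + ∣ a ∩ v ∣ * 2 ≡⟨ *-suc ∣ a ∩ v ∣ 2 ⟨
      ∣ a ∩ v ∣ * 3             ≡⟨ cong (∣ a ∩ v ∣ *_) (w≡2⇒rate3≡3 {a} wa≡2) ⟨
      ∣ a ∩ v ∣ * rate3 a       ∎

module Setting
  {n : ℕ} {𝒮 A B : List (Subset n)}
  (hereditary : Hereditary 𝒮)
  (A! : Unique A) (A-disjoint : PairwiseDisjoint A)
  (B⊆𝒮 : ∀ {s} → s ∈ B → s ∈ 𝒮) (B! : Unique B) (B-disjoint : PairwiseDisjoint B)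
  (no-improvement : NoLocalImprovementUpTo 2 𝒮 A)
  (card23A : Card23 A) (card23B : Card23 B)
  {v : Subset n} (v∈B : v ∈ B) (v∉B₁ : ¬ InB1 A v) (v∉B₂ : ¬ InB2 A v) (wv≡2 : w v ≡ 2)
  (v-A∖C : edgesTo (AminusC A B) v ≡ 2) (v-C : edgesTo (Cset A B) v ≡ 1)
  (toC3>1 : 1 < toC3 A B v)
  {u : Subset n} (u∈A : u ∈ A) (u∈C : InC A B u) (u∩v : 1 ≤ ∣ u ∩ v ∣)
  where

  u∈Cset : u ∈ Cset A B
  u∈Cset = ∈-filter⁺ (InC? A B) u∈A u∈C

  ∣u∩v∣≡1 : ∣ u ∩ v ∣ ≡ 1
  ∣u∩v∣≡1 = ≤-antisym (≤-trans (∈⇒≤sum (λ a → ∣ a ∩ v ∣) u∈Cset) (≤-reflexive v-C)) u∩v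

  edgesTo-A-v≡3 : edgesTo A v ≡ 3
  edgesTo-A-v≡3 =
    trans (sym (sum-filter+sum-filter-∁ (λ a → ∣ a ∩ v ∣) (InC? A B) A)) (cong₂ _+_ v-C v-A∖C)

  -- A second neighbour of v in C would give v two edges into C; a neighbour of weight 2
  -- in A ∖ C would take 1 from v, leaving at most 1/3 for u.
  other-neighbour⇒w≡1 : ∀ {a} → a ∈ A → a ≢ u → 1 ≤ ∣ a ∩ v ∣ → w a ≡ 1
  other-neighbour⇒w≡1 {a} a∈A a≢u a∩v with InC? A B a | w a ℕ.≟ 2
  ... | yes a∈C | _ = ⊥-elim (1+n≰n (begin
    2                     ≤⟨ +-mono-≤ a∩v u∩v ⟩
    ∣ a ∩ v ∣ + ∣ u ∩ v ∣ ≤⟨ distinct-∈⇒+≤sum (λ b → ∣ b ∩ v ∣)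
                               (∈-filter⁺ (InC? A B) a∈A a∈C) u∈Cset a≢u ⟩
    edgesTo (Cset A B) v  ≡⟨ v-C ⟩
    1                     ∎))
    where open ≤-Reasoning
  ... | no a∉C | yes wa≡2 = ⊥-elim (<⇒≱ toC3>1 (∸-monoʳ-≤ 6 4<sentOut3))
    where
    4<sentOut3 : 4 < sentOut3 A B v
    4<sentOut3 = subst (λ e → e * 2 < sentOut3 A B v) v-A∖C
      (weight2-neighbour⇒2*edges<sentOut3 {A = A} {B}
        (∈-filter⁺ (¬? ∘ InC? A B) a∈A a∉C) wa≡2 a∩v)
  ... | no _ | no wa≢2 = [ id , ⊥-elim ∘ wa≢2 ]′ (Card23⇒w≡1⊎w≡2 card23A a∈A)

  pair-improvement : ∀ {t} → t ∈ 𝒮 → v ≢ t → Disjoint v t → w t ≡ w u →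
    (∀ {a} → a ∈ A → 1 ≤ ∣ t ∩ a ∣ → a ≡ u) → ⊥
  pair-improvement {t} t∈𝒮 v≢t v∩t≡0 wt≡wu only-u = no-improvement X ≤-refl
    (weight≤∧count2<⇒LocalImprovement {A = A}
      (pair-feasible (B⊆𝒮 v∈B) t∈𝒮 v≢t v∩t≡0) wN≤wX count2<)
    where
    X : List (Subset n)
    X = v ∷ t ∷ []

    meets-v : ∀ {a} → a ∈ A → Meets X a → 1 ≤ ∣ a ∩ v ∣
    meets-v a∈A (here v∩a)         = 1≤∣p∩q∣-comm {p = v} v∩a
    meets-v a∈A (there (here t∩a)) = subst (λ b → 1 ≤ ∣ b ∩ v ∣) (sym (only-u a∈A t∩a)) u∩v

    w≤edges : ∀ {a} → a ∈ A → Meets X a → a ≢ u → w a ≤ ∣ a ∩ v ∣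
    w≤edges {a} a∈A a-meets a≢u = subst (_≤ ∣ a ∩ v ∣)
      (sym (other-neighbour⇒w≡1 a∈A a≢u (meets-v a∈A a-meets))) (meets-v a∈A a-meets)

    wu≤edges+wu∸1 : w u ≤ ∣ u ∩ v ∣ + (w u ∸ 1)
    wu≤edges+wu∸1 = subst (λ k → w u ≤ k + (w u ∸ 1)) (sym ∣u∩v∣≡1) (m≤n+m∸n (w u) 1)

    wN≤wX : wF (N X A) ≤ wF X
    wN≤wX = begin
      wF (N X A)
        ≤⟨ sum-filter-≤-except _≟ₛ_ w (λ a → ∣ a ∩ v ∣) (meets? X) (w u ∸ 1) A A!
             wu≤edges+wu∸1 w≤edges ⟩
      edgesTo A v + (w u ∸ 1) ≡⟨ cong (_+ (w u ∸ 1)) edgesTo-A-v≡3 ⟩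
      2 + (1 + (w u ∸ 1))     ≡⟨ cong (2 +_) (m+[n∸m]≡n (Card23⇒1≤w card23A u∈A)) ⟩
      2 + w u                 ≡⟨ cong₂ _+_ wv≡2 (trans (+-identityʳ (w t)) wt≡wu) ⟨
      wF X                    ∎
      where open ≤-Reasoning

    weight2⇒≡u : ∀ {a} → a ∈ N X A → w a ≡ 2 → a ≡ u
    weight2⇒≡u {a} a∈N wa≡2 = decidable-stable (a ≟ₛ u) λ a≢u →
      let a∈A , a-meets = ∈-filter⁻ (meets? X) a∈N
      in contradiction (trans (sym (other-neighbour⇒w≡1 a∈A a≢u (meets-v a∈A a-meets))) wa≡2) λ ()

    count2< : count2 (N X A) < count2 X
    count2< = begin-strict
      count2 (N X A)
        ≤⟨ count2≤count2-singleton {u = u} {t} (N X A) (Unique.filter⁺ (meets? X) A!)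
             weight2⇒≡u wt≡wu ⟩
      count2 (t ∷ [])       <⟨ n<1+n _ ⟩
      suc (count2 (t ∷ [])) ≡⟨ count2-∷-w≡2 {s = v} (t ∷ []) wv≡2 ⟨
      count2 X              ∎
      where open ≤-Reasoning

  x : Fin n
  x = proj₁ (1≤∣p∩q∣⇒∃ u v u∩v)

  x∈u : x ∈ₛ u
  x∈u = proj₁ (proj₂ (1≤∣p∩q∣⇒∃ u v u∩v))

  x∈v : x ∈ₛ v
  x∈v = proj₂ (proj₂ (1≤∣p∩q∣⇒∃ u v u∩v))

  donor≢ : ∀ {c b} → 1 ≤ step1 A c u → ¬ InB1 A b → ¬ InB2 A b → c ≢ b
  donor≢ {c} c-gives b∉B₁ b∉B₂ refl =
    [ b∉B₁ , b∉B₂ ]′ (Data.Sum.map proj₁ proj₁ (proj₂ (step1-positive⇒ A c u c-gives)))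

  donor-point∉v : ∀ {c y} → c ∈ B → 1 ≤ step1 A c u → y ∈ₛ c → y ∉ₛ v
  donor-point∉v c∈B c-gives = ≢⇒∉ B-disjoint c∈B v∈B (donor≢ c-gives v∉B₁ v∉B₂)

  donor-meets-u : ∀ c → 1 ≤ step1 A c u → ∃[ y ] y ∈ₛ u × y ∈ₛ c
  donor-meets-u c c-gives = 1≤∣p∩q∣⇒∃ u c (proj₁ (step1-positive⇒ A c u c-gives))

  module WeightOne (∣u∣≡2 : ∣ u ∣ ≡ 2) {c} (c∈B : c ∈ B) (c-gives : 1 ≤ step1 A c u) where

    ∉[x] : ∀ {y} → y ∈ₛ c → ¬ y ∈ x ∷ []
    ∉[x] y∈c (here refl) = donor-point∉v c∈B c-gives y∈c x∈v

    ∣u∩c∣≤1 : ∣ u ∩ c ∣ ≤ 1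
    ∣u∩c∣≤1 = subsingleton⇒∣p∣≤1 (u ∩ c) λ y∈u∩c z∈u∩c →
      let y∈u , y∈c = x∈p∩q⁻ u c y∈u∩c
          z∈u , z∈c = x∈p∩q⁻ u c z∈u∩c
      in at-most-one-outside (x ∷ []) ([] ∷ []) (x∈u ∷ []) (≤-reflexive ∣u∣≡2)
           y∈u z∈u (∉[x] y∈c) (∉[x] z∈c)

    edgesTo-A-c<∣c∣ : edgesTo A c < ∣ c ∣
    edgesTo-A-c<∣c∣ with step1-positive⇒ A c u c-gives
    ... | u∩c , inj₁ (c∈B₁ , _) = begin-strict
      edgesTo A c ≤⟨ others-zero⇒sum≤ _≟ₛ_ (λ a → ∣ a ∩ c ∣) A A! only-u ⟩
      ∣ u ∩ c ∣   ≤⟨ ∣u∩c∣≤1 ⟩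
      1           <⟨ ≤-refl ⟩
      2           ≤⟨ Card23⇒2≤∣s∣ card23B c∈B ⟩
      ∣ c ∣       ∎
      where
      open ≤-Reasoning
      only-u : ∀ {a} → a ∈ A → a ≢ u → ∣ a ∩ c ∣ ≡ 0
      only-u a∈A a≢u = n≤0⇒n≡0 (≮⇒≥ (a≢u ∘ λ a∩c → InB1⇒unique-neighbour c∈B₁ a∈A u∈A a∩c u∩c))
    ... | _ , inj₂ ((wc≡2 , edges≡2 , _) , _) =
      subst₂ _<_ (sym edges≡2) (sym (w≡2⇒∣s∣≡3 {s = c} wc≡2)) ≤-refl

    uncovered : ∃[ q ] q ∈ₛ c × ¬ Any (q ∈ₛ_) A
    uncovered = edges<∣c∣⇒∃uncovered c A edgesTo-A-c<∣c∣

    p q : Fin n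
    p = proj₁ (donor-meets-u c c-gives)
    q = proj₁ uncovered

    p∈u : p ∈ₛ u
    p∈u = proj₁ (proj₂ (donor-meets-u c c-gives))

    q-uncovered : ¬ Any (q ∈ₛ_) A
    q-uncovered = proj₂ (proj₂ uncovered)

    p≢q : p ≢ q
    p≢q p≡q = q-uncovered (lose u∈A (subst (_∈ₛ u) p≡q p∈u))

    t : Subset n
    t = ⁅ p ⁆ ∪ ⁅ q ⁆

    t⊆c : ∀ {y} → y ∈ₛ t → y ∈ₛ c
    t⊆c y∈t = [ (λ y≡p → subst (_∈ₛ c) (sym y≡p) (proj₂ (proj₂ (donor-meets-u c c-gives))))
              , (λ y≡q → subst (_∈ₛ c) (sym y≡q) (proj₁ (proj₂ uncovered)))
              ]′ (x∈⁅y⁆∪⁅z⁆⁻ p q y∈t)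

    wt≡1 : w t ≡ 1
    wt≡1 = cong (_∸ 1) (∣⁅x⁆∪⁅y⁆∣≡2 p≢q)

    only-u : ∀ {a} → a ∈ A → 1 ≤ ∣ t ∩ a ∣ → a ≡ u
    only-u a∈A t∩a with 1≤∣p∩q∣⇒∃ t _ t∩a
    ... | y , y∈t , y∈a with x∈⁅y⁆∪⁅z⁆⁻ p q y∈t
    ...   | inj₁ refl = common-point⇒≡ A-disjoint a∈A u∈A y∈a p∈u
    ...   | inj₂ refl = ⊥-elim (q-uncovered (lose a∈A y∈a))

    impossible : ⊥
    impossible = pair-improvement
      (hereditary (B⊆𝒮 c∈B) t⊆c (p , x∈p∪q⁺ (inj₁ (x∈⁅x⁆ p))))
      (λ v≡t → contradiction (trans (sym wv≡2) (trans (cong w v≡t) wt≡1)) λ ())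
      (no-common⇒∣p∩q∣≡0 v t (λ y∈v y∈t → donor-point∉v c∈B c-gives (t⊆c y∈t) y∈v))
      (trans wt≡1 (sym (cong (_∸ 1) ∣u∣≡2)))
      only-u

  Brest? : Decidable (λ b → ¬ InB1 A b × ¬ InB2 A b)
  Brest? b = ¬? (InB1? A b) ×-dec ¬? (InB2? A b)

  edges≢1⇒other-Brest-neighbour : edgesTo (Brest A B) u ≢ 1 →
    ∃[ b ] b ∈ Brest A B × b ≢ v × 1 ≤ ∣ b ∩ u ∣
  edges≢1⇒other-Brest-neighbour edges≢1 =
    >single⇒∃other _≟ₛ_ (λ b → ∣ b ∩ u ∣) (Brest A B) (Unique.filter⁺ Brest? B!) ∣v∩u∣<edges
    where
    ∣v∩u∣≡1 : ∣ v ∩ u ∣ ≡ 1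
    ∣v∩u∣≡1 = trans (cong ∣_∣ (∩-comm v u)) ∣u∩v∣≡1
    ∣v∩u∣≤edges : ∣ v ∩ u ∣ ≤ edgesTo (Brest A B) u
    ∣v∩u∣≤edges = ∈⇒≤sum (λ b → ∣ b ∩ u ∣) (∈-filter⁺ Brest? v∈B (v∉B₁ , v∉B₂))
    ∣v∩u∣<edges : ∣ v ∩ u ∣ < edgesTo (Brest A B) u
    ∣v∩u∣<edges = ≤∧≢⇒< ∣v∩u∣≤edges
      (λ ∣v∩u∣≡edges → edges≢1 (trans (sym ∣v∩u∣≡edges) ∣v∩u∣≡1))

  module WeightTwo (∣u∣≡3 : ∣ u ∣ ≡ 3) {c} (c∈B : c ∈ B) (c-gives : 1 ≤ step1 A c u)
                   {b} (b∈Brest : b ∈ Brest A B) (b≢v : b ≢ v) (b∩u : 1 ≤ ∣ b ∩ u ∣) where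

    wu≡2 : w u ≡ 2
    wu≡2 = cong (_∸ 1) ∣u∣≡3

    b∈B : b ∈ B
    b∈B = proj₁ (∈-filter⁻ Brest? {xs = B} b∈Brest)

    b∉B₁∪B₂ : ¬ InB1 A b × ¬ InB2 A b
    b∉B₁∪B₂ = proj₂ (∈-filter⁻ Brest? {xs = B} b∈Brest)

    z : Fin n
    z = proj₁ (1≤∣p∩q∣⇒∃ b u b∩u)

    z∈b : z ∈ₛ b
    z∈b = proj₁ (proj₂ (1≤∣p∩q∣⇒∃ b u b∩u))

    z∈u : z ∈ₛ u
    z∈u = proj₂ (proj₂ (1≤∣p∩q∣⇒∃ b u b∩u))

    x≢z : x ≢ z
    x≢z x≡z = ≢⇒∉ B-disjoint v∈B b∈B (b≢v ∘ sym) x∈v (subst (_∈ₛ b) (sym x≡z) z∈b)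

    ∉[x,z] : ∀ {c′ y} → c′ ∈ B → 1 ≤ step1 A c′ u → y ∈ₛ c′ → ¬ y ∈ x ∷ z ∷ []
    ∉[x,z] c′∈B c′-gives y∈c′ (here refl)         = donor-point∉v c′∈B c′-gives y∈c′ x∈v
    ∉[x,z] c′∈B c′-gives y∈c′ (there (here refl)) =
      ≢⇒∉ B-disjoint c′∈B b∈B (donor≢ c′-gives (proj₁ b∉B₁∪B₂) (proj₂ b∉B₁∪B₂)) y∈c′ z∈b

    donor-points-≡ : ∀ {c′ c″ y y′} → c′ ∈ B → c″ ∈ B → 1 ≤ step1 A c′ u → 1 ≤ step1 A c″ u →
      y ∈ₛ u → y ∈ₛ c′ → y′ ∈ₛ u → y′ ∈ₛ c″ → y ≡ y′
    donor-points-≡ c′∈B c″∈B c′-gives c″-gives y∈u y∈c′ y′∈u y′∈c″ =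
      at-most-one-outside (x ∷ z ∷ []) ((x≢z ∷ []) ∷ [] ∷ []) (x∈u ∷ z∈u ∷ []) (≤-reflexive ∣u∣≡3)
        y∈u y′∈u (∉[x,z] c′∈B c′-gives y∈c′) (∉[x,z] c″∈B c″-gives y′∈c″)

    ∣u∩c∣≤1 : ∣ u ∩ c ∣ ≤ 1
    ∣u∩c∣≤1 = subsingleton⇒∣p∣≤1 (u ∩ c) λ y∈u∩c y′∈u∩c →
      let y∈u , y∈c = x∈p∩q⁻ u c y∈u∩c
          y′∈u , y′∈c = x∈p∩q⁻ u c y′∈u∩c
      in donor-points-≡ c∈B c∈B c-gives c-gives y∈u y∈c y′∈u y′∈c

    donor≡c : ∀ {c′} → c′ ∈ B → 1 ≤ step1 A c′ u → c′ ≡ c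
    donor≡c {c′} c′∈B c′-gives =
      let y , y∈u , y∈c′ = donor-meets-u c′ c′-gives
          y′ , y′∈u , y′∈c = donor-meets-u c c-gives
          y≡y′ = donor-points-≡ c′∈B c∈B c′-gives c-gives y∈u y∈c′ y′∈u y′∈c
      in common-point⇒≡ B-disjoint c′∈B c∈B y∈c′ (subst (_∈ₛ c) (sym y≡y′) y′∈c)

    2≤c-gives : 2 ≤ step1 A c u
    2≤c-gives = begin
      2               ≡⟨ trans u∈C wu≡2 ⟨
      received1 A B u ≤⟨ others-zero⇒sum≤ _≟ₛ_ (λ c′ → step1 A c′ u) B B!
                           (λ c′∈B c′≢c → n≤0⇒n≡0 (≮⇒≥ (c′≢c ∘ donor≡c c′∈B))) ⟩
      step1 A c u     ∎
      where open ≤-Reasoning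

    impossible : ⊥
    impossible with step1-positive⇒ A c u c-gives
    ... | _ , inj₂ (_ , gives≡∣u∩c∣) =
      1+n≰n (≤-trans 2≤c-gives (≤-trans (≤-reflexive gives≡∣u∩c∣) ∣u∩c∣≤1))
    ... | u∩c , inj₁ (c∈B₁ , gives≡wc) =
      pair-improvement (B⊆𝒮 c∈B) v≢c (B-disjoint v∈B c∈B v≢c) (trans wc≡2 (sym wu≡2)) only-u
      where
      v≢c : v ≢ c
      v≢c = donor≢ c-gives v∉B₁ v∉B₂ ∘ sym
      wc≡2 : w c ≡ 2
      wc≡2 = [ (λ wc≡1 → ⊥-elim (1+n≰n (subst (2 ≤_) (trans gives≡wc wc≡1) 2≤c-gives))) , id ]′
               (Card23⇒w≡1⊎w≡2 card23B c∈B)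
      only-u : ∀ {a} → a ∈ A → 1 ≤ ∣ c ∩ a ∣ → a ≡ u
      only-u a∈A c∩a = InB1⇒unique-neighbour c∈B₁ a∈A u∈A (1≤∣p∩q∣-comm {p = c} c∩a) u∩c

lemma4 : ∀ {n : ℕ} (𝒮 A B : List (Subset n)) →
    IsInstance 𝒮 →
    Feasible 𝒮 A →
    NoLocalImprovementUpTo 10 𝒮 A →
    Optimum 𝒮 B →
    Card23 A →
    Card23 B →
    ∀ (v : Subset n) → InBd A B v →
    ∀ (u : Subset n) → u ∈ A → InC A B u → 1 ≤ ∣ u ∩ v ∣ →
    1 < toC3 A B v →
    w u ≡ 2 × edgesTo (Brest A B) u ≡ 1
lemma4 𝒮 A B (_ , _ , hereditary) ((A! , _) , A-disjoint) no-improvement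
       (((B! , B⊆𝒮) , B-disjoint) , _) card23A card23B
       v (v∈B , v∉B₁ , v∉B₂ , wv≡2 , v-A∖C , v-C) u u∈A u∈C u∩v toC3>1 =
  let c , c∈B , c-gives = InC⇒∃donor card23A u∈A u∈C in
  [ (λ ∣u∣≡2 → ⊥-elim (WeightOne.impossible ∣u∣≡2 c∈B c-gives))
  , (λ ∣u∣≡3 → cong (_∸ 1) ∣u∣≡3
             , decidable-stable (edgesTo (Brest A B) u ℕ.≟ 1) λ edges≢1 →
                 let b , b∈Brest , b≢v , b∩u = edges≢1⇒other-Brest-neighbour edges≢1
                 in WeightTwo.impossible ∣u∣≡3 c∈B c-gives b∈Brest b≢v b∩u)
  ]′ (card23A u∈A)
  where
  open Setting hereditary A! A-disjoint B⊆𝒮 B! B-disjoint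
               (λ X |X|≤2 → no-improvement X (≤-trans |X|≤2 (m≤m+n 2 8))) card23A card23B
               v∈B v∉B₁ v∉B₂ wv≡2 v-A∖C v-C toC3>1 u∈A u∈C u∩v
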